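{- In the generalized Zeckendorf game with $p\ge 5$ players on any $n\ge 14$, no player has a winning strategy.
   Context: Let $a_1=1$, $a_2=2$ and $a_{i+1}=i\,a_i+a_{i-1}$ for $i\ge 2$. The generalized Zeckendorf game on $n$: the state is a multiset of terms of the sequence, initially $n$ copies of $a_1=1$. A move is one of: (combining) replace two $1$'s by one $2$; or, for $i\ge 2$, if the multiset contains at least $i$ copies of $a_i$ and at least one $a_{i-1}$, replace $i$ copies of $a_i$ and one $a_{i-1}$ by one $a_{i+1}$; (splitting) if it contains three $2$'s, replace them by one $1$ and one $5$; or, for $i\ge 3$, if it contains $i+1$ copies of $a_i$, replace them by one $a_{i+1}$, $i-2$ copies of $a_{i-1}$ and one $a_{i-2}$. Players $1,2,\dots,p$ move in cyclic order (player 1 first) until no move is available; the player making the last move wins. A player has a winning strategy if that player can guarantee making the last move regardless of the moves of all other players. -}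

module Defs where

open import Data.Nat using (ℕ; zero; suc; _+_; _*_; _∸_; _≤_; _<_; _≡ᵇ_)
open import Data.Bool using (if_then_else_)
open import Data.Product using (∃)
open import Data.Sum using (_⊎_)
open import Relation.Nullary using (¬_)
open import Relation.Binary.PropositionalEquality using (_≡_; _≢_)

-- The sequence a_1 = 1, a_2 = 2, a_{i+1} = i a_i + a_{i-1}  (a 0 is an unused dummy).
a : ℕ → ℕ
a 0 = 0
a 1 = 1
a 2 = 2
a (suc (suc (suc m))) = suc (suc m) * a (suc (suc m)) + a (suc m)

-- A state (a multiset of terms of the sequence) is given by its multiplicities:
-- s i = number of copies of a_i in the multiset (i ≥ 1; s 0 is ignored).
-- The terms a_i are pairwise distinct, so this is the same as a multiset of terms.
State : Set
State = ℕ → ℕ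

adj : ℕ → (ℕ → ℕ) → State → State
adj i f s j = if j ≡ᵇ i then f (s j) else s j

init : ℕ → State
init n 1 = n
init n _ = 0

data Move (s : State) : State → Set where
  comb1 : 2 ≤ s 1 → Move s (adj 2 suc (adj 1 (_∸ 2) s))
  -- i = m+2 ≥ 2 : i copies of a_i and one a_{i-1} -> one a_{i+1}
  combi : ∀ m → suc (suc m) ≤ s (suc (suc m)) → 1 ≤ s (suc m) →
          Move s (adj (3 + m) suc (adj (2 + m) (_∸ (2 + m)) (adj (1 + m) (_∸ 1) s)))
  -- three 2's -> one 1 and one 5 (= a_3)
  split2 : 3 ≤ s 2 → Move s (adj 1 suc (adj 3 suc (adj 2 (_∸ 3) s)))
  -- i = m+3 ≥ 3 : i+1 copies of a_i -> one a_{i+1}, i-2 copies of a_{i-1}, one a_{i-2}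
  spliti : ∀ m → 4 + m ≤ s (3 + m) →
           Move s (adj (1 + m) suc (adj (2 + m) (_+ (1 + m)) (adj (4 + m) suc (adj (3 + m) (_∸ (4 + m)) s))))

Terminal : State → Set
Terminal s = ∀ t → ¬ Move s t

-- players are 0 , 1 , … , p-1 (player j here is player j+1 of the paper); cyclic successor
next : ℕ → ℕ → ℕ
next p j = if suc j ≡ᵇ p then 0 else suc j

-- CanWin p k s j : in the game with p players, at state s with player j to move,
-- player k can guarantee to make the last move, whatever all other players do.
data CanWin (p k : ℕ) : State → ℕ → Set where
  mine  : ∀ {s t j} → j ≡ k → Move s t → (Terminal t ⊎ CanWin p k t (next p j)) → CanWin p k s j
  other : ∀ {s j} → j ≢ k → ∃ (Move s) →
          (∀ t → Move s t → CanWin p k t (next p j)) → CanWin p k s j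

HasWinningStrategy : ℕ → ℕ → ℕ → Set
HasWinningStrategy p n k = CanWin p k (init n) 0

{-# OPTIONS --safe #-}
module Submission where

-- From a position with at least four 1's and a 2, the moves 1+1→2, 2+2+1→5 and the moves
-- 1+1→2, 1+1→2, 2+2+2→1+5 lead to the same position, in two and in three moves. A position
-- cannot be won by a player both with player j and with player j+1 to move (the same plays
-- continue from it, with the last move shifted by one player), so three consecutive opponents
-- of player k can always spoil k's strategy. With at least five players and at least fourteen
-- 1's, such a stretch of three opponents occurs early in the game, whatever k does on its
-- first turn.

open import Defs
open import Data.Nat using (ℕ; zero; suc; _+_; _∸_; _≤_; _<_; z≤n; s≤s; _≡ᵇ_)
open import Data.Nat.Properties using (≡ᵇ⇒≡; 1+n≢n; m≤m+n; ≤-trans; <-irrefl; ∸-monoˡ-≤; +-∸-assoc; m≤n⇒∃[o]m+o≡n)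
open import Data.Bool using (true; false; T)
open import Data.Unit using (tt)
open import Data.Empty using (⊥-elim)
open import Data.Product using (∃; _,_; _×_)
open import Data.Sum using (_⊎_; inj₁; inj₂)
open import Function using (_∘_)
open import Relation.Nullary using (¬_)
open import Relation.Binary.PropositionalEquality

infix 4 _≐_

_≐_ : State → State → Set
s ≐ t = ∀ i → s i ≡ t i

≐-sym : ∀ {s t} → s ≐ t → t ≐ s
≐-sym s≐t i = sym (s≐t i)

adj-cong : ∀ i f {s t} → s ≐ t → adj i f s ≐ adj i f t
adj-cong i f s≐t j with j ≡ᵇ i
... | true  = cong f (s≐t j)
... | false = s≐t j

Move-resp-≐ : ∀ {s s′ t} → s ≐ s′ → Move s t → ∃ λ t′ → Move s′ t′ × t ≐ t′
Move-resp-≐ s≐s′ (comb1 h) =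
  _ , comb1 (subst (2 ≤_) (s≐s′ 1) h) , adj-cong 2 suc (adj-cong 1 (_∸ 2) s≐s′)
Move-resp-≐ s≐s′ (combi m h h′) =
  _ , combi m (subst (2 + m ≤_) (s≐s′ _) h) (subst (1 ≤_) (s≐s′ _) h′)
    , adj-cong (3 + m) suc (adj-cong (2 + m) (_∸ (2 + m)) (adj-cong (1 + m) (_∸ 1) s≐s′))
Move-resp-≐ s≐s′ (split2 h) =
  _ , split2 (subst (3 ≤_) (s≐s′ 2) h) , adj-cong 1 suc (adj-cong 3 suc (adj-cong 2 (_∸ 3) s≐s′))
Move-resp-≐ s≐s′ (spliti m h) =
  _ , spliti m (subst (4 + m ≤_) (s≐s′ _) h)
    , adj-cong (1 + m) suc (adj-cong (2 + m) (_+ (1 + m)) (adj-cong (4 + m) suc (adj-cong (3 + m) (_∸ (4 + m)) s≐s′)))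

Terminal-resp-≐ : ∀ {t t′} → t ≐ t′ → Terminal t → Terminal t′
Terminal-resp-≐ t≐t′ term _ mv with Move-resp-≐ (≐-sym t≐t′) mv
... | _ , mv′ , _ = term _ mv′

CanWin-resp-≐ : ∀ {p k s s′ j} → s ≐ s′ → CanWin p k s j → CanWin p k s′ j
CanWin-resp-≐ s≐s′ (mine j≡k mv rest) with Move-resp-≐ s≐s′ mv | rest
... | _ , mv′ , t≐t′ | inj₁ term = mine j≡k mv′ (inj₁ (Terminal-resp-≐ t≐t′ term))
... | _ , mv′ , t≐t′ | inj₂ win  = mine j≡k mv′ (inj₂ (CanWin-resp-≐ t≐t′ win))
CanWin-resp-≐ {s′ = s′} s≐s′ (other j≢k (_ , mv) win) with Move-resp-≐ s≐s′ mv
... | _ , mv′ , _ = other j≢k (_ , mv′) win′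
  where
  win′ : ∀ u → Move s′ u → CanWin _ _ u _
  win′ u mu with Move-resp-≐ (≐-sym s≐s′) mu
  ... | _ , mu′ , u′≐u = CanWin-resp-≐ (≐-sym u′≐u) (win _ mu′)

Terminal⇒¬CanWin : ∀ {p k t j} → Terminal t → ¬ CanWin p k t j
Terminal⇒¬CanWin term (mine _ mv _)       = term _ mv
Terminal⇒¬CanWin term (other _ (_ , mv) _) = term _ mv

next-cases : ∀ p j → next p j ≡ 0 ⊎ next p j ≡ suc j
next-cases p j with suc j ≡ᵇ p
... | true  = inj₁ refl
... | false = inj₂ refl

next-≢ : ∀ p j {c} → 0 ≢ c → suc j ≢ c → next p j ≢ c
next-≢ p j 0≢c 1+j≢c with next-cases p j
... | inj₁ eq = 0≢c ∘ trans (sym eq)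
... | inj₂ eq = 1+j≢c ∘ trans (sym eq)

next-next-≢ : ∀ p j {c} → 0 ≢ c → 1 ≢ c → 2 + j ≢ c → next p (next p j) ≢ c
next-next-≢ p j 0≢c 1≢c 2+j≢c with next-cases p j
... | inj₁ eq = subst (λ i → next p i ≢ _) (sym eq) (next-≢ p 0 0≢c 1≢c)
... | inj₂ eq = subst (λ i → next p i ≢ _) (sym eq) (next-≢ p (suc j) 0≢c 2+j≢c)

next-≢-self : ∀ {p} j → 2 ≤ p → next p j ≢ j
next-≢-self {p} j 2≤p with suc j ≡ᵇ p in eq
... | false = 1+n≢n
... | true  = λ { refl → <-irrefl refl (subst (2 ≤_) (sym (≡ᵇ⇒≡ 1 p (subst T (sym eq) tt))) 2≤p) }

CanWin-step : ∀ {p k s j} → CanWin p k s j →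
              ∃ λ t → Move s t × (Terminal t ⊎ CanWin p k t (next p j))
CanWin-step (mine _ mv rest)       = _ , mv , rest
CanWin-step (other _ (_ , mv) win) = _ , mv , inj₂ (win _ mv)

CanWin-nonterminal : ∀ {p k t u j} → Move t u → Terminal t ⊎ CanWin p k t j → CanWin p k t j
CanWin-nonterminal mv (inj₁ term) = ⊥-elim (term _ mv)
CanWin-nonterminal mv (inj₂ win)  = win

CanWin-after-opponent : ∀ {p k s t j} → j ≢ k → CanWin p k s j → Move s t → CanWin p k t (next p j)
CanWin-after-opponent j≢k (mine j≡k _ _) _ = ⊥-elim (j≢k j≡k)
CanWin-after-opponent _   (other _ _ win) mv = win _ mv

¬CanWin-consecutive-turns : ∀ {p k s j} → 2 ≤ p → CanWin p k s j → ¬ CanWin p k s (next p j)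
¬CanWin-consecutive-turns {j = j} 2≤p (mine j≡k _ _) (mine j′≡k _ _) =
  next-≢-self j 2≤p (trans j′≡k (sym j≡k))
¬CanWin-consecutive-turns 2≤p (mine _ mv (inj₁ term)) (other _ _ win′) = Terminal⇒¬CanWin term (win′ _ mv)
¬CanWin-consecutive-turns 2≤p (mine _ mv (inj₂ win)) (other _ _ win′)  = ¬CanWin-consecutive-turns 2≤p win (win′ _ mv)
¬CanWin-consecutive-turns 2≤p (other _ _ win) (mine _ mv (inj₁ term))  = Terminal⇒¬CanWin term (win _ mv)
¬CanWin-consecutive-turns 2≤p (other _ _ win) (mine _ mv (inj₂ win′))  = ¬CanWin-consecutive-turns 2≤p (win _ mv) win′
¬CanWin-consecutive-turns 2≤p (other _ (_ , mv) win) (other _ _ win′) = ¬CanWin-consecutive-turns 2≤p (win _ mv) (win′ _ mv)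

combine₁ combine₂ split₂ : State → State
combine₁ s = adj 2 suc (adj 1 (_∸ 2) s)
combine₂ s = adj 3 suc (adj 2 (_∸ 2) (adj 1 (_∸ 1) s))
split₂ s = adj 1 suc (adj 3 suc (adj 2 (_∸ 3) s))

two-routes-agree : ∀ s → 4 ≤ s 1 → combine₂ (combine₁ s) ≐ split₂ (combine₁ (combine₁ s))
two-routes-agree s 4≤s₁ 1 = +-∸-assoc 1 (∸-monoˡ-≤ 2 4≤s₁)
two-routes-agree s 4≤s₁ 0 = refl
two-routes-agree s 4≤s₁ 2 = refl
two-routes-agree s 4≤s₁ 3 = refl
two-routes-agree s 4≤s₁ (suc (suc (suc (suc i)))) = refl

three-opponent-turns⇒¬CanWin : ∀ {p k s j} → 2 ≤ p → 4 ≤ s 1 → 1 ≤ s 2 →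
  j ≢ k → next p j ≢ k → next p (next p j) ≢ k → ¬ CanWin p k s j
three-opponent-turns⇒¬CanWin {s = s} 2≤p 4≤s₁ 1≤s₂ j≢k j′≢k j″≢k win =
  ¬CanWin-consecutive-turns 2≤p
    (CanWin-resp-≐ (two-routes-agree s 4≤s₁)
      (CanWin-after-opponent j′≢k win₁ (combi 0 (s≤s 1≤s₂) (≤-trans (s≤s z≤n) 2≤s₁∸2))))
    (CanWin-after-opponent j″≢k
      (CanWin-after-opponent j′≢k win₁ (comb1 2≤s₁∸2)) (split2 (s≤s (s≤s 1≤s₂))))
  where
  2≤s₁∸2 : 2 ≤ s 1 ∸ 2
  2≤s₁∸2 = ∸-monoˡ-≤ 2 4≤s₁
  win₁ : CanWin _ _ (combine₁ s) _
  win₁ = CanWin-after-opponent j≢k win (comb1 (≤-trans (s≤s (s≤s z≤n)) 4≤s₁))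

module _ (q m : ℕ) where
  private
    p : ℕ
    p = 5 + q

    2≤p : 2 ≤ p
    2≤p = m≤m+n 2 _

    s₀ s₂ : State
    s₀ = init (14 + m)
    s₂ = combine₁ (combine₁ s₀)

    CanWin-after-two-combines : ∀ {k} → 0 ≢ k → 1 ≢ k → CanWin p k s₀ 0 → CanWin p k s₂ 2
    CanWin-after-two-combines 0≢k 1≢k win =
      CanWin-after-opponent 1≢k (CanWin-after-opponent 0≢k win (comb1 (m≤m+n 2 _))) (comb1 (m≤m+n 2 _))

  ¬CanWin-beyond-4 : ∀ k → ¬ CanWin p (4 + k) s₀ 0
  ¬CanWin-beyond-4 k win =
    three-opponent-turns⇒¬CanWin 2≤p (m≤m+n 4 _) (m≤m+n 1 _) (λ ()) (λ ()) (λ ())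
      (CanWin-after-opponent (λ ()) win (comb1 (m≤m+n 2 _)))

  ¬CanWin-0 : ¬ CanWin p 0 s₀ 0
  ¬CanWin-0 win with CanWin-step win
  ... | _ , comb1 _ , rest =
    three-opponent-turns⇒¬CanWin 2≤p (m≤m+n 4 _) (m≤m+n 1 _) (λ ()) (λ ()) (λ ())
      (CanWin-nonterminal (comb1 (m≤m+n 2 _)) rest)
  ... | _ , combi _ () _ , _
  ... | _ , split2 () , _
  ... | _ , spliti _ () , _

  ¬CanWin-1 : ¬ CanWin p 1 s₀ 0
  ¬CanWin-1 win with CanWin-step (CanWin-after-opponent (λ ()) win (comb1 (m≤m+n 2 _)))
  ... | _ , comb1 _ , rest =
    three-opponent-turns⇒¬CanWin 2≤p (m≤m+n 4 _) (m≤m+n 1 _) (λ ()) (λ ()) (λ ())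
      (CanWin-nonterminal (comb1 (m≤m+n 2 _)) rest)
  ... | _ , combi zero (s≤s ()) _ , _
  ... | _ , combi (suc _) () _ , _
  ... | _ , split2 (s≤s ()) , _
  ... | _ , spliti _ () , _

  ¬CanWin-2 : ¬ CanWin p 2 s₀ 0
  ¬CanWin-2 win with CanWin-step (CanWin-after-two-combines (λ ()) (λ ()) win)
  ... | _ , comb1 _ , rest =
    three-opponent-turns⇒¬CanWin 2≤p (m≤m+n 4 _) (m≤m+n 1 _) (λ ()) (λ ()) (next-≢ p 4 (λ ()) (λ ()))
      (CanWin-nonterminal (comb1 (m≤m+n 2 _)) rest)
  ... | _ , combi zero _ _ , rest =
    three-opponent-turns⇒¬CanWin 2≤p (m≤m+n 4 _) (m≤m+n 1 _) (λ ())
      (next-≢ p 4 (λ ()) (λ ()))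
      (next-next-≢ p 4 (λ ()) (λ ()) (λ ()))
      (CanWin-after-opponent (λ ()) (CanWin-nonterminal (comb1 (m≤m+n 2 _)) rest) (comb1 (m≤m+n 2 _)))
  ... | _ , combi (suc _) () _ , _
  ... | _ , split2 (s≤s (s≤s ())) , _
  ... | _ , spliti _ () , _

  ¬CanWin-3 : ¬ CanWin p 3 s₀ 0
  ¬CanWin-3 win
    with CanWin-step (CanWin-after-opponent (λ ())
                       (CanWin-after-two-combines (λ ()) (λ ()) win) (combi 0 (m≤m+n 2 _) (m≤m+n 1 _)))
  ... | _ , comb1 _ , rest =
    three-opponent-turns⇒¬CanWin 2≤p (m≤m+n 4 _) (m≤m+n 1 _) (λ ())
      (next-≢ p 4 (λ ()) (λ ()))
      (next-next-≢ p 4 (λ ()) (λ ()) (λ ()))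
      (CanWin-nonterminal (comb1 (m≤m+n 2 _)) rest)
  ... | _ , combi zero () _ , _
  ... | _ , combi (suc zero) (s≤s ()) _ , _
  ... | _ , combi (suc (suc _)) () _ , _
  ... | _ , split2 () , _
  ... | _ , spliti zero (s≤s ()) , _
  ... | _ , spliti (suc _) () , _

  ¬CanWin-init : ∀ k → ¬ CanWin p k s₀ 0
  ¬CanWin-init 0 = ¬CanWin-0
  ¬CanWin-init 1 = ¬CanWin-1
  ¬CanWin-init 2 = ¬CanWin-2
  ¬CanWin-init 3 = ¬CanWin-3
  ¬CanWin-init (suc (suc (suc (suc k)))) = ¬CanWin-beyond-4 k

lemma7p5 : (p : ℕ) → 5 ≤ p → (n : ℕ) → 14 ≤ n → (k : ℕ) → k < p → ¬ HasWinningStrategy p n k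
lemma7p5 p 5≤p n 14≤n k _ = from-offsets (m≤n⇒∃[o]m+o≡n 5≤p) (m≤n⇒∃[o]m+o≡n 14≤n)
  where
  from-offsets : (∃ λ q → 5 + q ≡ p) → (∃ λ m → 14 + m ≡ n) → ¬ HasWinningStrategy p n k
  from-offsets (q , refl) (m , refl) = ¬CanWin-init q m k
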